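{- Let $X$, GreedyArb, $j,k,P,Q,Q_r,R_P,M^P_p$ and $C_t$ be as in the context. Let $p\in X$ be the point with $p.y=t$, and suppose $p\in Q\cup Q_r$. Then (1) if $|M^P_p|=0$, then $|C_{t+1}|=|C_t|$; and (2) if $|M^P_p|>0$, then $|C_{t+1}|\le |C_t|-(|M^P_p|-1)$.
   Context: Let $n\ge1$ and $X=\{p_1,\dots,p_n\}\subset\mathbb{Z}^2$ with $p_i=(i,t_i)$, where $(t_1,\dots,t_n)$ is a permutation of $\{1,\dots,n\}$; $a.x,a.y$ denote the coordinates of a point $a$. For points $a,b$ not on a common horizontal or vertical line, $\Box ab$ is the closed axis-parallel rectangle with opposite corners $a,b$. GreedyArb: for $t=1,\dots,n$ in order, let $p$ be the point of $X$ with $p.y=t$ and let $Z_t$ be the set of points of $X$ with $y$-coordinate $<t$ together with all points added at earlier steps; add $M_p=\{(q.x,t): q\in Z_t,\ q.x\ne p.x,\ \Box pq\text{ contains no point of }Z_t\cup\{p\}\text{ other than }p,q\}$. Let $Y=\bigcup_{p\in X}M_p$. Fix integers $j,k\ge1$ with $j+2k-1\le n$. Let $P=\{p_j,\dots,p_{j+k-1}\}$, $Q=\{p_{j+k},\dots,p_{j+2k-1}\}$, $Q_r=\{p_{j+2k},\dots,p_n\}$, and $R_P=\{(x,y): j-\tfrac12<x<j+k-\tfrac12\}$. For $p\in X$, $M^P_p=M_p\cap R_P$. For an integer $t$, let $Z^P_{<t}$ be the set of points of $X\cup Y$ lying in $R_P$ with $y$-coordinate $<t$. A point $q\in Z^P_{<t}$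 is a corner point in $P$ for $Q$ at time $t$ if there is no $q'\in Z^P_{<t}\setminus\{q\}$ with $q'.x\ge q.x$ and $q'.y\ge q.y$. $C_t$ denotes the set of corner points in $P$ for $Q$ at time $t$. -}

module Defs where

open import Data.Nat using (ℕ; zero; suc; _+_; _∸_; _≤_; _<_; _⊓_; _⊔_; pred)
open import Data.Product using (Σ; _×_; _,_; proj₁; proj₂)
open import Data.Sum using (_⊎_)
open import Data.Empty using (⊥)
open import Data.List using (List; length)
open import Data.List.Membership.Propositional using (_∈_)
open import Data.List.Relation.Unary.Unique.Propositional using (Unique)
open import Relation.Binary.PropositionalEquality using (_≡_; _≢_)
open import Relation.Nullary using (¬_)

-- Points of the integer grid.  All points ever considered have coordinates
-- in {1,…,n}, so ℕ × ℕ suffices.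
Point : Set
Point = ℕ × ℕ

_·x : Point → ℕ
p ·x = proj₁ p

_·y : Point → ℕ
p ·y = proj₂ p

IsPerm : ℕ → (ℕ → ℕ) → Set
IsPerm n τ =
  (∀ i → 1 ≤ i → i ≤ n → 1 ≤ τ i × τ i ≤ n) ×
  (∀ i i' → 1 ≤ i → i ≤ n → 1 ≤ i' → i' ≤ n → τ i ≡ τ i' → i ≡ i')

InX : ℕ → (ℕ → ℕ) → Point → Set
InX n τ r = 1 ≤ r ·x × r ·x ≤ n × τ (r ·x) ≡ r ·y

InRect : Point → Point → Point → Set
InRect p q s =
  (p ·x ⊓ q ·x ≤ s ·x × s ·x ≤ p ·x ⊔ q ·x) ×
  (p ·y ⊓ q ·y ≤ s ·y × s ·y ≤ p ·y ⊔ q ·y)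

-- Zs n τ t         : Z_{t+1} = points of X with y < t+1, plus points added at steps ≤ t.
--   MStep n τ t p r  : r ∈ M_p, for p the point of X with p.y = t+1
--                      (computed from Z_{t+1}).
mutual
  Added : ℕ → (ℕ → ℕ) → ℕ → Point → Set
  Added n τ zero r = ⊥
  Added n τ (suc t) r =
    Added n τ t r ⊎ (Σ Point λ p → InX n τ p × p ·y ≡ suc t × MStep n τ t p r)

  Zs : ℕ → (ℕ → ℕ) → ℕ → Point → Set
  Zs n τ t q = (InX n τ q × q ·y < suc t) ⊎ Added n τ t q

  MStep : ℕ → (ℕ → ℕ) → ℕ → Point → Point → Set
  MStep n τ t p r =
    r ·y ≡ p ·y ×
    Σ Point λ q →
      Zs n τ t q × q ·x ≡ r ·x × q ·x ≢ p ·x ×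
      (∀ s → InRect p q s → (Zs n τ t s ⊎ s ≡ p) → s ≡ p ⊎ s ≡ q)

-- M_p for p ∈ X (p.y ≥ 1, so the step is t = p.y and Z_t = Zs (p.y - 1))
M : ℕ → (ℕ → ℕ) → Point → Point → Set
M n τ p r = MStep n τ (pred (p ·y)) p r

InY : ℕ → (ℕ → ℕ) → Point → Set
InY n τ r = Added n τ n r

-- R_P = {(x,y) : j - 1/2 < x < j + k - 1/2}; for integer x this is j ≤ x < j + k
InRP : ℕ → ℕ → Point → Set
InRP j k r = j ≤ r ·x × r ·x < j + k

MP : ℕ → (ℕ → ℕ) → ℕ → ℕ → Point → Point → Set
MP n τ j k p r = M n τ p r × InRP j k r

ZP : ℕ → (ℕ → ℕ) → ℕ → ℕ → ℕ → Point → Set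
ZP n τ j k t r = (InX n τ r ⊎ InY n τ r) × InRP j k r × r ·y < t

Corner : ℕ → (ℕ → ℕ) → ℕ → ℕ → ℕ → Point → Set
Corner n τ j k t q =
  ZP n τ j k t q ×
  (∀ q' → ZP n τ j k t q' → q' ≢ q → ¬ (q ·x ≤ q' ·x × q ·y ≤ q' ·y))

HasSize : (Point → Set) → ℕ → Set
HasSize S m =
  Σ (List Point) λ l → Unique l × length l ≡ m × (∀ r → (r ∈ l → S r) × (S r → r ∈ l))

-- Since p lies to the right of R_P, the points of Z^P_{<t+1} on row t are exactly those of M^P_p.
-- If there are none, C_{t+1} = C_t.  Otherwise at most one corner of C_{t+1} lies on row t, and
-- the other corners of C_{t+1} together with the points of M^P_p occupy pairwise distinct columns,
-- each containing a corner of C_t: a corner of C_{t+1} below row t is already in C_t, and the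
-- column of r ∈ M^P_p contains the point q that produced r, a corner of C_t because □pq is empty.
-- Hence |C_{t+1}| - 1 + |M^P_p| ≤ |C_t|.
module Submission where

open import Defs
open import Data.Nat
  using (ℕ; zero; suc; _+_; _∸_; _≤_; _<_; _*_; z≤n; s≤s; _≤′_; ≤′-refl; ≤′-step; _<?_; _≟_)
open import Data.Nat.Properties
open import Data.Product using (∃-syntax; _×_; _,_; proj₁; proj₂)
open import Data.Product.Properties using (≡-dec)
open import Data.Sum as Sum using (inj₁; inj₂; [_,_])
open import Function using (_∘_)
open import Data.List using (List; []; _∷_; length; filter; _++_)
open import Data.List.Properties using (length-++; length-removeAt)
open import Data.List.Relation.Unary.Any as Any using (here; there; _─_)
import Data.List.Relation.Unary.All as All
open import Data.List.Relation.Unary.AllPairs using (_∷_)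
open import Data.List.Membership.Propositional using (_∈_)
open import Data.List.Membership.Propositional.Properties
  using (∈-filter⁺; ∈-filter⁻; ∈-++⁺ˡ; ∈-++⁺ʳ; ∈-++⁻)
open import Data.List.Relation.Unary.Unique.Propositional using (Unique)
import Data.List.Relation.Unary.Unique.Propositional.Properties as Unique
open import Relation.Binary.PropositionalEquality using (_≡_; _≢_; refl; sym; trans; cong; cong₂; subst)
open import Relation.Nullary using (¬_; ¬?; yes; no; contradiction)
open import Relation.Nullary.Decidable using (decidable-stable)
open import Relation.Unary using (Pred; Decidable; _⊆_; _≐_; _∩_; _∪_; ∁; _⊥_)

module _ {A : Set} where

  ∈-─ : ∀ {x y : A} {ys} (x∈ys : x ∈ ys) → y ∈ ys → y ≢ x → y ∈ (ys ─ x∈ys)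
  ∈-─ (here refl) (here refl) y≢x = contradiction refl y≢x
  ∈-─ (here refl) (there y∈ys) _  = y∈ys
  ∈-─ (there _)   (here refl) _   = here refl
  ∈-─ (there x∈ys) (there y∈ys) y≢x = there (∈-─ x∈ys y∈ys y≢x)

  length-─ : ∀ {x : A} {ys} (x∈ys : x ∈ ys) → suc (length (ys ─ x∈ys)) ≡ length ys
  length-─ {ys = y ∷ ys} x∈ys = cong suc (length-removeAt (y ∷ ys) (Any.index x∈ys))

module _ {A K : Set} (key : A → K) where

  length-≤-by-key : ∀ {xs ys : List A} → Unique xs →
    (∀ {x x'} → x ∈ xs → x' ∈ xs → key x ≡ key x' → x ≡ x') →
    (∀ {x} → x ∈ xs → ∃[ y ] y ∈ ys × key y ≡ key x) →
    length xs ≤ length ys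
  length-≤-by-key {[]} _ _ _ = z≤n
  length-≤-by-key {x ∷ xs} {ys} (x∉xs ∷ xs-unique) inj match with match (here refl)
  ... | y , y∈ys , ky≡kx =
    subst (suc (length xs) ≤_) (length-─ y∈ys) (s≤s (length-≤-by-key xs-unique inj′ match′))
    where
    inj′ : ∀ {x x'} → x ∈ xs → x' ∈ xs → key x ≡ key x' → x ≡ x'
    inj′ x∈xs x'∈xs = inj (there x∈xs) (there x'∈xs)

    match′ : ∀ {x'} → x' ∈ xs → ∃[ y' ] y' ∈ (ys ─ y∈ys) × key y' ≡ key x'
    match′ x'∈xs with match (there x'∈xs)
    ... | y' , y'∈ys , ky'≡kx' = y' , ∈-─ y∈ys y'∈ys y'≢y , ky'≡kx'
      where
      y'≢y : y' ≢ y
      y'≢y refl = All.lookup x∉xs x'∈xs (inj (here refl) (there x'∈xs) (trans (sym ky≡kx) ky'≡kx'))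

HasSize-≤-by-key : ∀ {K : Set} (key : Point → K) {S T : Pred Point _} {m c} →
  HasSize S m → HasSize T c →
  (∀ {x x'} → S x → S x' → key x ≡ key x' → x ≡ x') →
  (∀ {x} → S x → ∃[ y ] T y × key y ≡ key x) →
  m ≤ c
HasSize-≤-by-key key (l , l-unique , refl , l≐S) (l' , _ , refl , l'≐T) inj match =
  length-≤-by-key key l-unique
    (λ x∈l x'∈l → inj (proj₁ (l≐S _) x∈l) (proj₁ (l≐S _) x'∈l))
    (λ x∈l → let y , Ty , ky≡kx = match (proj₁ (l≐S _) x∈l) in y , proj₂ (l'≐T y) Ty , ky≡kx)

HasSize-mono : ∀ {S T : Pred Point _} {m c} → HasSize S m → HasSize T c → S ⊆ T → m ≤ c
HasSize-mono |S| |T| S⊆T =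
  HasSize-≤-by-key (λ x → x) |S| |T| (λ _ _ eq → eq) (λ Sx → _ , S⊆T Sx , refl)

HasSize-unique : ∀ {S T : Pred Point _} {m c} → HasSize S m → HasSize T c → S ≐ T → m ≡ c
HasSize-unique |S| |T| (S⊆T , T⊆S) = ≤-antisym (HasSize-mono |S| |T| S⊆T) (HasSize-mono |T| |S| T⊆S)

HasSize-∩ : ∀ {S P : Pred Point _} {m} → Decidable P → HasSize S m → ∃[ f ] HasSize (S ∩ P) f
HasSize-∩ P? (l , l-unique , _ , l≐S) =
  _ , filter P? l , Unique.filter⁺ P? l-unique , refl ,
  λ x → (λ x∈fl → let x∈l , Px = ∈-filter⁻ P? x∈fl in proj₁ (l≐S x) x∈l , Px) ,
        (λ (Sx , Px) → ∈-filter⁺ P? (proj₂ (l≐S x) Sx) Px)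

HasSize-∪ : ∀ {S T : Pred Point _} {a b} → HasSize S a → HasSize T b → S ⊥ T →
  HasSize (S ∪ T) (a + b)
HasSize-∪ {S} {T} (l , l-unique , refl , l≐S) (l' , l'-unique , refl , l'≐T) S⊥T =
  l ++ l' , Unique.++⁺ l-unique l'-unique disjoint , length-++ l , l++l'≐S∪T
  where
  disjoint : ∀ {x} → ¬ (x ∈ l × x ∈ l')
  disjoint (x∈l , x∈l') = S⊥T (proj₁ (l≐S _) x∈l , proj₁ (l'≐T _) x∈l')

  l++l'≐S∪T : ∀ x → (x ∈ l ++ l' → (S ∪ T) x) × ((S ∪ T) x → x ∈ l ++ l')
  l++l'≐S∪T x = Sum.map (proj₁ (l≐S x)) (proj₁ (l'≐T x)) ∘ ∈-++⁻ l ,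
                [ ∈-++⁺ˡ ∘ proj₂ (l≐S x) , ∈-++⁺ʳ l ∘ proj₂ (l'≐T x) ]

HasSize-≤1 : ∀ {S : Pred Point _} {m} → HasSize S m → (∀ {x y} → S x → S y → x ≡ y) → m ≤ 1
HasSize-≤1 ([] , _ , refl , _) _ = z≤n
HasSize-≤1 (x ∷ [] , _ , refl , _) _ = s≤s z≤n
HasSize-≤1 (x ∷ y ∷ _ , (x∉ ∷ _) , refl , l≐S) subsingleton =
  contradiction (subsingleton (proj₁ (l≐S x) (here refl)) (proj₁ (l≐S y) (there (here refl))))
                (All.head x∉)

HasSize-≤-suc : ∀ {S P : Pred Point _} {m f} → Decidable P → HasSize S m → HasSize (S ∩ P) f →
  (∀ {x y} → (S ∩ ∁ P) x → (S ∩ ∁ P) y → x ≡ y) → m ≤ suc f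
HasSize-≤-suc {S} {P} {m} {f} P? |S| |S∩P| subsingleton = begin
  m     ≡⟨ HasSize-unique |S| |S∩P∪S∩∁P| (split , merge) ⟩
  f + g ≤⟨ +-monoʳ-≤ f (HasSize-≤1 |S∩∁P| subsingleton) ⟩
  f + 1 ≡⟨ +-comm f 1 ⟩
  suc f ∎
  where
  open ≤-Reasoning

  g : ℕ
  g = proj₁ (HasSize-∩ (¬? ∘ P?) |S|)

  |S∩∁P| : HasSize (S ∩ ∁ P) g
  |S∩∁P| = proj₂ (HasSize-∩ (¬? ∘ P?) |S|)

  |S∩P∪S∩∁P| : HasSize ((S ∩ P) ∪ (S ∩ ∁ P)) (f + g)
  |S∩P∪S∩∁P| = HasSize-∪ |S∩P| |S∩∁P| (λ ((_ , Px) , (_ , ¬Px)) → ¬Px Px)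

  split : S ⊆ (S ∩ P) ∪ (S ∩ ∁ P)
  split {x} Sx with P? x
  ... | yes Px = inj₁ (Sx , Px)
  ... | no ¬Px = inj₂ (Sx , ¬Px)

  merge : (S ∩ P) ∪ (S ∩ ∁ P) ⊆ S
  merge = Sum.[ proj₁ , proj₁ ]

m≤1+n∧n+o≤p⇒m+[o∸1]≤p : ∀ {m n o p} → m ≤ suc n → n + o ≤ p → 1 ≤ o → m + (o ∸ 1) ≤ p
m≤1+n∧n+o≤p⇒m+[o∸1]≤p {m} {n} {suc o} {p} m≤1+n n+1+o≤p _ = begin
  m + o     ≤⟨ +-monoˡ-≤ o m≤1+n ⟩
  suc n + o ≡⟨ +-suc n o ⟨
  n + suc o ≤⟨ n+1+o≤p ⟩
  p         ∎
  where open ≤-Reasoning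

HasSize-0 : ∀ {S : Pred Point _} {x} → HasSize S 0 → ¬ S x
HasSize-0 ([] , _ , _ , l≐S) Sx with () ← proj₂ (l≐S _) Sx

module GreedyArb (n : ℕ) (τ : ℕ → ℕ) where

  Added-y≤ : ∀ {s r} → Added n τ s r → r ·y ≤ s
  Added-y≤ {suc s} (inj₁ r-added) = m≤n⇒m≤1+n (Added-y≤ r-added)
  Added-y≤ {suc s} (inj₂ (_ , _ , p·y≡1+s , r·y≡p·y , _)) = ≤-reflexive (trans r·y≡p·y p·y≡1+s)

  Added-at-own-row : ∀ {s r} → Added n τ s r → Added n τ (r ·y) r
  Added-at-own-row {suc s} (inj₁ r-added) = Added-at-own-row r-added
  Added-at-own-row {suc s} {r} (inj₂ step@(_ , _ , p·y≡1+s , r·y≡p·y , _)) =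
    subst (λ u → Added n τ u r) (sym (trans r·y≡p·y p·y≡1+s)) (inj₂ step)

  Added-mono : ∀ {s s' r} → s ≤′ s' → Added n τ s r → Added n τ s' r
  Added-mono ≤′-refl          r-added = r-added
  Added-mono (≤′-step s≤′s') r-added = inj₁ (Added-mono s≤′s' r-added)

  InX⇒1≤y≤n : IsPerm n τ → ∀ {r} → InX n τ r → 1 ≤ r ·y × r ·y ≤ n
  InX⇒1≤y≤n (τ∈[1,n] , _) (1≤x , x≤n , τx≡y) =
    subst (λ u → 1 ≤ u × u ≤ n) τx≡y (τ∈[1,n] _ 1≤x x≤n)

  module Corners (j k : ℕ) where

    ZP⇒Zs : ∀ {s r} → ZP n τ j k (suc s) r → Zs n τ s r
    ZP⇒Zs (inj₁ r∈X , _ , r·y<1+s) = inj₁ (r∈X , r·y<1+s)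
    ZP⇒Zs (inj₂ r∈Y , _ , r·y<1+s) =
      inj₂ (Added-mono (≤⇒≤′ (m<1+n⇒m≤n r·y<1+s)) (Added-at-own-row r∈Y))

    Zs⇒ZP : ∀ {s r} → s < n → Zs n τ s r → InRP j k r → ZP n τ j k (suc s) r
    Zs⇒ZP _   (inj₁ (r∈X , r·y<1+s)) r∈RP = inj₁ r∈X , r∈RP , r·y<1+s
    Zs⇒ZP s<n (inj₂ r-added)         r∈RP =
      inj₂ (Added-mono (≤⇒≤′ (<⇒≤ s<n)) r-added) , r∈RP , s≤s (Added-y≤ r-added)

    Corner-maximal : ∀ {s q q'} → Corner n τ j k s q → ZP n τ j k s q' →
      q ·x ≤ q' ·x → q ·y ≤ q' ·y → q' ≡ q
    Corner-maximal {q = q} {q'} (_ , undominated) q'∈ZP q·x≤ q·y≤ =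
      decidable-stable (≡-dec _≟_ _≟_ q' q) λ q'≢q → undominated q' q'∈ZP q'≢q (q·x≤ , q·y≤)

    Corner-unique-in-row : ∀ {s q q'} → Corner n τ j k s q → Corner n τ j k s q' →
      q ·y ≡ q' ·y → q ≡ q'
    Corner-unique-in-row {q = q} {q'} q∈C q'∈C same-row with ≤-total (q ·x) (q' ·x)
    ... | inj₁ q·x≤ = sym (Corner-maximal q∈C (proj₁ q'∈C) q·x≤ (≤-reflexive same-row))
    ... | inj₂ q'·x≤ = Corner-maximal q'∈C (proj₁ q∈C) q'·x≤ (≤-reflexive (sym same-row))

    TopOfColumn : ℕ → Point → Set
    TopOfColumn s q = ∀ {q'} → ZP n τ j k s q' → q' ·x ≡ q ·x → q ·y ≤ q' ·y → q' ≡ q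

    Corner⇒TopOfColumn : ∀ {s q} → Corner n τ j k s q → TopOfColumn s q
    Corner⇒TopOfColumn q∈C q'∈ZP same-column =
      Corner-maximal q∈C q'∈ZP (≤-reflexive (sym same-column))

    TopRow⇒TopOfColumn : ∀ {s q} → q ·y ≡ s → TopOfColumn (suc s) q
    TopRow⇒TopOfColumn q·y≡s (_ , _ , q'·y<1+s) same-column q·y≤ =
      cong₂ _,_ same-column (≤-antisym (subst (_ ≤_) (sym q·y≡s) (m<1+n⇒m≤n q'·y<1+s)) q·y≤)

    TopOfColumn-unique : ∀ {s q q'} → ZP n τ j k s q → ZP n τ j k s q' →
      TopOfColumn s q → TopOfColumn s q' → q ·x ≡ q' ·x → q ≡ q'
    TopOfColumn-unique {q = q} {q'} q∈ZP q'∈ZP q-top q'-top same-column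
      with ≤-total (q ·y) (q' ·y)
    ... | inj₁ q·y≤ = sym (q-top q'∈ZP (sym same-column) q·y≤)
    ... | inj₂ q'·y≤ = q'-top q∈ZP same-column q'·y≤

    ZP-suc : ∀ {s r} → ZP n τ j k s r → ZP n τ j k (suc s) r
    ZP-suc (r∈X∪Y , r∈RP , r·y<s) = r∈X∪Y , r∈RP , m≤n⇒m≤1+n r·y<s

    Corner-pred : ∀ {s q} → Corner n τ j k (suc s) q → q ·y < s → Corner n τ j k s q
    Corner-pred ((q∈X∪Y , q∈RP , _) , undominated) q·y<s =
      (q∈X∪Y , q∈RP , q·y<s) , λ q' q'∈ZP → undominated q' (ZP-suc q'∈ZP)

    Corner-suc-≐ : ∀ {s} → (∀ {r} → ZP n τ j k (suc s) r → r ·y < s) →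
      Corner n τ j k s ≐ Corner n τ j k (suc s)
    Corner-suc-≐ {s} row-s-empty = lift , λ q∈C' → Corner-pred q∈C' (row-s-empty (proj₁ q∈C'))
      where
      lower : ZP n τ j k (suc s) ⊆ ZP n τ j k s
      lower r∈ZP@(r∈X∪Y , r∈RP , _) = r∈X∪Y , r∈RP , row-s-empty r∈ZP

      lift : Corner n τ j k s ⊆ Corner n τ j k (suc s)
      lift (q∈ZP , undominated) = ZP-suc q∈ZP , λ q' q'∈ZP → undominated q' (lower q'∈ZP)

    module Step (perm : IsPerm n τ) {a s : ℕ} (p∈X : InX n τ (a , suc s)) (RP<p : j + k ≤ a) where

      p : Point
      p = a , suc s

      s<n : s < n
      s<n = proj₂ (InX⇒1≤y≤n perm p∈X)

      X-row-p : ∀ {r} → InX n τ r → r ·y ≡ suc s → r ·x ≡ a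
      X-row-p (1≤x , x≤n , τx≡y) r·y≡1+s =
        let 1≤a , a≤n , τa≡1+s = p∈X
        in proj₂ perm _ a 1≤x x≤n 1≤a a≤n (trans τx≡y (trans r·y≡1+s (sym τa≡1+s)))

      RP<p·x : ∀ {r} → InRP j k r → r ·x < a
      RP<p·x (_ , r·x<j+k) = <-≤-trans r·x<j+k RP<p

      MP⇒ZP : ∀ {r} → MP n τ j k p r → ZP n τ j k (suc (suc s)) r
      MP⇒ZP (r∈M@(r·y≡1+s , _) , r∈RP) =
        inj₂ (Added-mono (≤⇒≤′ s<n) (inj₂ (p , p∈X , refl , r∈M))) , r∈RP ,
        s≤s (≤-reflexive r·y≡1+s)

      ZP-row-p⇒MP : ∀ {r} → ZP n τ j k (suc (suc s)) r → r ·y ≡ suc s → MP n τ j k p r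
      ZP-row-p⇒MP {r} (inj₁ r∈X , r∈RP , _) r·y≡1+s =
        contradiction (X-row-p r∈X r·y≡1+s) (<⇒≢ (RP<p·x {r} r∈RP))
      ZP-row-p⇒MP {r} (inj₂ r∈Y , r∈RP , _) r·y≡1+s
        with subst (λ u → Added n τ u r) r·y≡1+s (Added-at-own-row r∈Y)
      ... | inj₁ r-added-earlier = contradiction (s≤s (Added-y≤ r-added-earlier)) (<-irrefl r·y≡1+s)
      ... | inj₂ (p' , p'∈X , refl , r∈Mp') with X-row-p p'∈X refl
      ... | refl = r∈Mp' , r∈RP

      MP-witness : ∀ {r} → MP n τ j k p r → ∃[ q ] Corner n τ j k (suc s) q × q ·x ≡ r ·x
      MP-witness ((_ , q , q∈Z , q·x≡r·x , _ , empty-box) , r∈RP) =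
        q , (q∈ZP , undominated) , q·x≡r·x
        where
        q∈RP : InRP j k q
        q∈RP = subst (j ≤_) (sym q·x≡r·x) (proj₁ r∈RP) ,
               subst (_< j + k) (sym q·x≡r·x) (proj₂ r∈RP)

        q∈ZP : ZP n τ j k (suc s) q
        q∈ZP = Zs⇒ZP s<n q∈Z q∈RP

        -- A point dominating q lies in □pq, because p is to the right of R_P and above row s.
        undominated : ∀ q' → ZP n τ j k (suc s) q' → q' ≢ q → ¬ (q ·x ≤ q' ·x × q ·y ≤ q' ·y)
        undominated q' q'∈ZP@(_ , q'∈RP , q'·y<1+s) q'≢q (q·x≤ , q·y≤)
          with empty-box q' ((m≤n⇒o⊓m≤n a q·x≤ , m≤n⇒m≤n⊔o (q ·x) (<⇒≤ (RP<p·x {q'} q'∈RP))) ,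
                             (m≤n⇒o⊓m≤n (suc s) q·y≤ , m≤n⇒m≤n⊔o (q ·y) (<⇒≤ q'·y<1+s)))
                            (inj₁ (ZP⇒Zs q'∈ZP))
        ... | inj₁ refl = <-irrefl refl (RP<p·x {q'} q'∈RP)
        ... | inj₂ q'≡q = q'≢q q'≡q

      module _ {m c c'} (|M| : HasSize (MP n τ j k p) m)
                        (|C| : HasSize (Corner n τ j k (suc s)) c)
                        (|C'| : HasSize (Corner n τ j k (suc (suc s))) c') where

        corners-unchanged : m ≡ 0 → c' ≡ c
        corners-unchanged refl = sym (HasSize-unique |C| |C'| (Corner-suc-≐ below-row-p))
          where
          below-row-p : ∀ {r} → ZP n τ j k (suc (suc s)) r → r ·y < suc s
          below-row-p r∈ZP@(_ , _ , r·y<2+s) with m<1+n⇒m<n∨m≡n r·y<2+s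
          ... | inj₁ r·y<1+s = r·y<1+s
          ... | inj₂ r·y≡1+s = contradiction (ZP-row-p⇒MP r∈ZP r·y≡1+s) (HasSize-0 |M|)

        corners-drop : 1 ≤ m → c' + (m ∸ 1) ≤ c
        corners-drop 1≤m = m≤1+n∧n+o≤p⇒m+[o∸1]≤p c'≤1+f f+m≤c 1≤m
          where
          Below : Pred Point _
          Below q = q ·y < suc s

          below? : Decidable Below
          below? q = q ·y <? suc s

          Lower : Pred Point _
          Lower = Corner n τ j k (suc (suc s)) ∩ Below

          f : ℕ
          f = proj₁ (HasSize-∩ below? |C'|)

          |Lower| : HasSize Lower f
          |Lower| = proj₂ (HasSize-∩ below? |C'|)

          on-row-p : ∀ {q} → (Corner n τ j k (suc (suc s)) ∩ ∁ Below) q → q ·y ≡ suc s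
          on-row-p (((_ , _ , q·y<2+s) , _) , ¬q·y<1+s) =
            ≤-antisym (m<1+n⇒m≤n q·y<2+s) (≮⇒≥ ¬q·y<1+s)

          c'≤1+f : c' ≤ suc f
          c'≤1+f = HasSize-≤-suc below? |C'| |Lower|
            λ q∉Lower q'∉Lower → Corner-unique-in-row (proj₁ q∉Lower) (proj₁ q'∉Lower)
                                   (trans (on-row-p q∉Lower) (sym (on-row-p q'∉Lower)))

          ZP∩Top : ∀ {q} → (Lower ∪ MP n τ j k p) q →
                   ZP n τ j k (suc (suc s)) q × TopOfColumn (suc (suc s)) q
          ZP∩Top (inj₁ (q∈C' , _)) = proj₁ q∈C' , Corner⇒TopOfColumn q∈C'
          ZP∩Top (inj₂ q∈MP)       = MP⇒ZP q∈MP , TopRow⇒TopOfColumn (proj₁ (proj₁ q∈MP))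

          column-injective : ∀ {q q'} → (Lower ∪ MP n τ j k p) q → (Lower ∪ MP n τ j k p) q' →
                             q ·x ≡ q' ·x → q ≡ q'
          column-injective q∈ q'∈ with ZP∩Top q∈ | ZP∩Top q'∈
          ... | q∈ZP , q-top | q'∈ZP , q'-top = TopOfColumn-unique q∈ZP q'∈ZP q-top q'-top

          column-witness : ∀ {q} → (Lower ∪ MP n τ j k p) q →
                           ∃[ q' ] Corner n τ j k (suc s) q' × q' ·x ≡ q ·x
          column-witness (inj₁ (q∈C' , q·y<1+s)) = _ , Corner-pred q∈C' q·y<1+s , refl
          column-witness (inj₂ q∈MP)             = MP-witness q∈MP

          f+m≤c : f + m ≤ c
          f+m≤c = HasSize-≤-by-key _·x (HasSize-∪ |Lower| |M| Lower⊥MP) |C|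
                    column-injective column-witness
            where
            Lower⊥MP : Lower ⊥ MP n τ j k p
            Lower⊥MP ((_ , q·y<1+s) , ((q·y≡1+s , _) , _)) = <-irrefl q·y≡1+s q·y<1+s

lemma2 : (n : ℕ) (τ : ℕ → ℕ) → 1 ≤ n → IsPerm n τ →
    (j k : ℕ) → 1 ≤ j → 1 ≤ k → j + 2 * k ∸ 1 ≤ n →
    (t : ℕ) (p : Point) → InX n τ p → proj₂ p ≡ t → j + k ≤ proj₁ p →
    (m c c' : ℕ) →
    HasSize (MP n τ j k p) m →
    HasSize (Corner n τ j k t) c →
    HasSize (Corner n τ j k (suc t)) c' →
    (m ≡ 0 → c' ≡ c) × (1 ≤ m → c' + (m ∸ 1) ≤ c)
lemma2 n τ _ perm j k _ _ _ .0 (a , zero) p∈X refl _ _ _ _ _ _ _ =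
  contradiction (proj₁ (InX⇒1≤y≤n perm p∈X)) λ ()
  where open GreedyArb n τ
lemma2 n τ _ perm j k _ _ _ .(suc s) (a , suc s) p∈X refl RP<p _ _ _ |M| |C| |C'| =
  corners-unchanged |M| |C| |C'| , corners-drop |M| |C| |C'|
  where open GreedyArb.Corners.Step n τ j k perm p∈X RP<p
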